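{- Let $\mathit{Acc}$ be a batch-mode hardware accelerator and $\mathit{Spec}:(A\times D)\times S_R\to O$ an abstract specification function. If $\mathit{Acc}$ is strongly connected, single-action correct with respect to $\mathit{Spec}$, and not functionally correct with respect to $\mathit{Spec}$ (i.e., has a bug), then $\mathit{Acc}$ is not functionally consistent.
   Context: A batch-mode hardware accelerator (HA) is a tuple $\mathit{Acc}=(b,A,D,O,S,s_{c,I},s_{c,F},S_{m,I},T)$ where: $b\ge 1$ is an integer (batch size); $A$, $D$, $O$ are finite sets (actions, data, outputs); $S=S_C\times S_M$ with $S_C$ the control states and $S_M=S_{In}\times S_{Out}\times S_R\times S_N$ the memory states, where $S_{In}=(A\times D)^b$, $S_{Out}=O^b$, $S_R$ (relevant states), $S_N$ (non-relevant states); $s_{c,I}\in S_C$ is the initial control state, with initial states $S_I=\{s_{c,I}\}\times S_M$; $s_{c,F}\in S_C$ the final control state, with final states $S_F=\{s_{c,F}\}\times S_M$; $S_{m,I}\subseteq S_M$ gives the concrete initial states $S_{CI}=\{s_{c,I}\}\times S_{m,I}$; $T:S\to S$ is the transition function. For $s=(s_c,(s_{in},s_{out},s_r,s_n))$: $\mathit{ctrl}(s)=s_c$, $\mathit{mem}(s)$ its memory state, $\mathit{inp}(s)=s_{in}$, $\mathit{out}(s)=s_{out}$, $\mathit{rel}(s)=s_r$. Input batches are $in\in(A\times D)^b$ with components $in(j)$; similarly $o(j)$ for $o\in O^b$. For $s_0\in S_I$, $\mathbf{T}(s_0)=\langle s_1,\dots,s_k\rangle$ with $s_i=T(s_{i-1})$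 and $k$ least with $s_k\in S_F$ (assumed to exist, with $\mathit{ctrl}(s_i)\neq s_{c,I}$ for $i>0$). For $\mathbf{in}=\langle in_1,\dots,in_n\rangle$ and $s_0\in S_I$, $\mathit{StateSeq}(\mathbf{in},s_0)$: let $s_0'$ be $s_0$ with $\mathit{inp}(s_0)$ replaced by $in_1$ and $\mathbf{s}'=s_0'\cdot\mathbf{T}(s_0')$; if $n=1$ the result is $\mathbf{s}'$; else with $s_f$ the unique final state of $\mathbf{s}'$ and $s_i=(s_{c,I},\mathit{mem}(s_f))$, the result is $\mathbf{s}'\cdot\mathit{StateSeq}(\langle in_2,\dots,in_n\rangle,s_i)$. $\mathit{initsym}(\mathbf{s})$, $\mathit{final}(\mathbf{s})$ are the subsequences of initial, resp. final, states. A state $s$ is reachable if $s\in S_{CI}$ or $s\in\mathit{StateSeq}(\mathbf{in},s_0)$ for some $s_0\in S_{CI}$ and sequence $\mathbf{in}$; a relevant state $r$ is reachable if $r=\mathit{rel}(s)$ for some reachable $s$. $\mathit{Spec}:(A\times D)\times S_R\to O$. Functional correctness w.r.t. $\mathit{Spec}$: for all $s_0\in S_{CI}$ and all $\mathbf{in}=\langle in_1,\dots,in_n\rangle$, with $\mathbf{s}=\mathit{StateSeq}(\mathbf{in},s_0)$, $\mathit{initsym}(\mathbf{s})=\langle s_{I,1},\dots,s_{I,n}\rangle$, $\mathit{out}(\mathit{final}(\mathbf{s}))=\langle o_1,\dots,o_n\rangle$: $o_n(j)=\mathit{Spec}(in_n(j),\mathit{rel}(s_{I,n}))$ for all $j\in[1,b]$.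 Functional consistency: for all such $s_0$, $\mathbf{in}$ (same notation), all $i\in[1,n]$, $j,j'\in[1,b]$: $in_i(j)=in_n(j')\wedge\mathit{rel}(s_{I,i})=\mathit{rel}(s_{I,n})\Rightarrow o_i(j)=o_n(j')$. Single-action correctness w.r.t. $\mathit{Spec}$: for every $(a,d)\in A\times D$ and every reachable relevant state $r$ there is a reachable initial state $s\in S_I$ and an index $j$ with $\mathit{inp}(s)(j)=(a,d)$, $\mathit{rel}(s)=r$, and $\mathit{out}(\mathit{final}(\mathbf{T}(s)))(j)=\mathit{Spec}((a,d),r)$. $\mathit{Acc}$ is strongly connected if there exists a sequence of state transitions from every reachable state to every other reachable state. -}

module Defs where

open import Data.Nat using (ℕ; zero; suc; _≤_; _<_)
open import Data.Fin using (Fin)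
open import Data.Product using (Σ; ∃; ∃-syntax; _×_; _,_; proj₁; proj₂)
open import Data.Sum using (_⊎_)
open import Data.List using (List; []; _∷_; _++_; _∷ʳ_)
open import Data.List.Membership.Propositional using (_∈_)
open import Function.Bundles using (_↔_)
open import Relation.Binary.PropositionalEquality using (_≡_; _≢_)
open import Relation.Binary.Construct.Closure.ReflexiveTransitive using (Star)
open import Relation.Nullary using (¬_)

iterate : {X : Set} → (X → X) → ℕ → X → X
iterate f zero x = x
iterate f (suc k) x = iterate f k (f x)

iters : {X : Set} → (X → X) → ℕ → X → List X
iters f zero x = []
iters f (suc k) x = f x ∷ iters f k (f x)

data Filter {X : Set} (P : X → Set) : List X → List X → Set where
  []   : Filter P [] []
  keep : ∀ {x xs ys} → P x → Filter P xs ys → Filter P (x ∷ xs) (x ∷ ys)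
  drop : ∀ {x xs ys} → ¬ P x → Filter P xs ys → Filter P (x ∷ xs) ys

data At {X : Set} : List X → ℕ → X → Set where
  here  : ∀ {x xs} → At (x ∷ xs) zero x
  there : ∀ {y xs i x} → At xs i x → At (y ∷ xs) (suc i) x

Finite : Set → Set
Finite X = Σ ℕ λ n → X ↔ Fin n

-- memory states S_M = S_In × S_Out × S_R × S_N, S_In = (A×D)^b, S_Out = O^b
MemT : ℕ → Set → Set → Set → Set → Set → Set
MemT b A D O SR SN = (Fin b → A × D) × (Fin b → O) × SR × SN

record HA : Set₁ where
  field
    b        : ℕ
    b≥1      : 1 ≤ b
    A D O    : Set
    A-finite : Finite A
    D-finite : Finite D
    O-finite : Finite O
    SC SR SN : Set
    cI cF    : SC
    SmI      : MemT b A D O SR SN → Set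
    T        : SC × MemT b A D O SR SN → SC × MemT b A D O SR SN
    -- standing assumption: from every initial state a final state is reached
    -- after k ≥ 1 steps, and no state after the first is initial
    halts    : ∀ (s : SC × MemT b A D O SR SN) → proj₁ s ≡ cI →
               ∃[ k ] (1 ≤ k × proj₁ (iterate T k s) ≡ cF
                  × (∀ i → 1 ≤ i → i ≤ k → proj₁ (iterate T i s) ≢ cI))

module _ (Acc : HA) where
  open HA Acc

  Mem : Set
  Mem = MemT b A D O SR SN

  State : Set
  State = SC × Mem

  Batch : Set
  Batch = Fin b → A × D

  ctrl : State → SC
  ctrl = proj₁

  mem : State → Mem
  mem = proj₂

  inp : State → Batch
  inp s = proj₁ (mem s)

  out : State → Fin b → O
  out s = proj₁ (proj₂ (mem s))

  rel : State → SR
  rel s = proj₁ (proj₂ (proj₂ (mem s)))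

  nrel : State → SN
  nrel s = proj₂ (proj₂ (proj₂ (mem s)))

  IsInit : State → Set
  IsInit s = ctrl s ≡ cI

  IsFinal : State → Set
  IsFinal s = ctrl s ≡ cF

  IsConcreteInit : State → Set
  IsConcreteInit s = IsInit s × SmI (mem s)

  load : Batch → State → State
  load i s = (ctrl s , (i , out s , rel s , nrel s))

  reset : State → State
  reset s = (cI , mem s)

  Run : State → List State → State → Set
  Run s ss sf = ∃[ k ] (1 ≤ k × ss ≡ iters T k s × sf ≡ iterate T k s
                        × IsFinal sf
                        × (∀ i → 1 ≤ i → i < k → ¬ IsFinal (iterate T i s)))

  data StateSeq : List Batch → State → List State → Set where
    one  : ∀ {i s₀ ss sf} → Run (load i s₀) ss sf →
           StateSeq (i ∷ []) s₀ (load i s₀ ∷ ss)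
    more : ∀ {i i′ ins s₀ ss sf rest} → Run (load i s₀) ss sf →
           StateSeq (i′ ∷ ins) (reset sf) rest →
           StateSeq (i ∷ i′ ∷ ins) s₀ (load i s₀ ∷ ss ++ rest)

  Reachable : State → Set
  Reachable s = IsConcreteInit s
              ⊎ ∃[ s₀ ] ∃[ ins ] ∃[ ss ] (IsConcreteInit s₀ × StateSeq ins s₀ ss × s ∈ ss)

  ReachableRel : SR → Set
  ReachableRel r = ∃[ s ] (Reachable s × rel s ≡ r)

  data Step : State → State → Set where
    tstep : ∀ {s} → ¬ IsFinal s → Step s (T s)
    reload : ∀ {s} (i : Batch) → IsFinal s → Step s (load i (reset s))

  StronglyConnected : Set
  StronglyConnected = ∀ s s′ → Reachable s → Reachable s′ → Star Step s s′

  module _ (Spec : (A × D) × SR → O) where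

    FunctionallyCorrect : Set
    FunctionallyCorrect =
      ∀ s₀ → IsConcreteInit s₀ → ∀ ins ss → StateSeq ins s₀ ss →
      ∀ is fs → Filter IsInit ss is → Filter IsFinal ss fs →
      ∀ ins′ inₙ is′ sIₙ fs′ sFₙ →
      ins ≡ ins′ ∷ʳ inₙ → is ≡ is′ ∷ʳ sIₙ → fs ≡ fs′ ∷ʳ sFₙ →
      ∀ (j : Fin b) → out sFₙ j ≡ Spec (inₙ j , rel sIₙ)

    FunctionallyConsistent : Set
    FunctionallyConsistent =
      ∀ s₀ → IsConcreteInit s₀ → ∀ ins ss → StateSeq ins s₀ ss →
      ∀ is fs → Filter IsInit ss is → Filter IsFinal ss fs →
      ∀ ins′ inₙ is′ sIₙ fs′ sFₙ →
      ins ≡ ins′ ∷ʳ inₙ → is ≡ is′ ∷ʳ sIₙ → fs ≡ fs′ ∷ʳ sFₙ →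
      ∀ (i : ℕ) inᵢ sIᵢ sFᵢ → At ins i inᵢ → At is i sIᵢ → At fs i sFᵢ →
      ∀ (j j′ : Fin b) → inᵢ j ≡ inₙ j′ → rel sIᵢ ≡ rel sIₙ →
      out sFᵢ j ≡ out sFₙ j′

    SingleActionCorrect : Set
    SingleActionCorrect =
      ∀ (ad : A × D) (r : SR) → ReachableRel r →
      ∃[ s ] (Reachable s × IsInit s × ∃[ j ] (inp s j ≡ ad × rel s ≡ r
               × ∃[ ss ] ∃[ sf ] (Run s ss sf × out sf j ≡ Spec (ad , r))))

module Submission where

-- Suppose Acc is functionally consistent, and fix a state sequence whose last batch inₙ starts
-- in sIₙ and finishes in sFₙ, and a lane j.  Single-action correctness yields a reachable initial
-- state y which, in some lane j′, holds the action inₙ j, has the relevant state of sIₙ, and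
-- computes Spec correctly.  By strong connectivity sFₙ reaches y; such a path is a succession of
-- runs separated by reloads, so it continues the sequence to one whose last batch starts in y.
-- Consistency compares lane j of the old last batch with lane j′ of the new one, so sFₙ outputs
-- Spec (inₙ j , rel sIₙ) in lane j: Acc is functionally correct.

open import Defs
open import Data.Product using (_×_)
open import Relation.Nullary using (¬_)
open import Data.Nat using (ℕ; zero; suc; _≤_; _<_; z≤n; s≤s)
open import Data.Nat.Properties using (≤-refl; ≮⇒≥; <-≤-trans; m<1+n⇒m<n∨m≡n; +-cancelʳ-≡)
open import Data.Product using (∃; _,_; proj₁; proj₂)
open import Data.Sum using (inj₁; inj₂)
open import Data.Empty using (⊥-elim)
open import Data.List using (List; []; _∷_; _++_; _∷ʳ_; [_]; length)
open import Data.List.Properties using (++-assoc; ∷ʳ-++; ∷ʳ-injective; length-++)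
open import Data.List.Membership.Propositional using (_∈_)
open import Data.List.Membership.Propositional.Properties using (∈-++⁺ʳ)
open import Data.List.Relation.Unary.Any using (here; there)
open import Relation.Binary.PropositionalEquality using (_≡_; refl; sym; trans; cong; subst; subst₂)
open import Relation.Binary.Construct.Closure.ReflexiveTransitive using (Star; ε; _◅_)

module _ {X : Set} where

  ∷ʳ-∈ : ∀ (xs : List X) x → x ∈ xs ∷ʳ x
  ∷ʳ-∈ xs x = ∈-++⁺ʳ xs (here refl)

  ++-∷ʳ : ∀ (xs : List X) {ys ys′ y} → ys ≡ ys′ ∷ʳ y → xs ++ ys ≡ (xs ++ ys′) ∷ʳ y
  ++-∷ʳ xs {ys′ = ys′} {y} refl = sym (++-assoc xs ys′ [ y ])

  At-length : ∀ (xs : List X) x ys → At (xs ++ x ∷ ys) (length xs) x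
  At-length []       x ys = here
  At-length (_ ∷ xs) x ys = there (At-length xs x ys)

  iterate-suc : ∀ (f : X → X) k x → iterate f (suc k) x ≡ f (iterate f k x)
  iterate-suc f zero    x = refl
  iterate-suc f (suc k) x = iterate-suc f k (f x)

length-∷ʳ-injective : ∀ {X Y : Set} (xs : List X) (ys : List Y) {x y} →
                      length (xs ∷ʳ x) ≡ length (ys ∷ʳ y) → length xs ≡ length ys
length-∷ʳ-injective xs ys eq =
  +-cancelʳ-≡ 1 (length xs) (length ys) (trans (sym (length-++ xs)) (trans eq (length-++ ys)))

At-∷ʳ-++ : ∀ {X Y : Set} {xs xs′ : List X} {x} {ys ys′ : List Y} {y} zs →
           xs ≡ xs′ ∷ʳ x → ys ≡ ys′ ∷ʳ y → length xs ≡ length ys → At (xs ++ zs) (length ys′) x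
At-∷ʳ-++ {xs′ = xs′} {x} {ys′ = ys′} zs refl refl eq =
  subst₂ (λ l n → At l n x) (sym (∷ʳ-++ xs′ x zs)) (length-∷ʳ-injective xs′ ys′ eq)
         (At-length xs′ x zs)

module _ {X : Set} {P : X → Set} where

  Filter-unique : ∀ {xs ys zs} → Filter P xs ys → Filter P xs zs → ys ≡ zs
  Filter-unique []         []          = refl
  Filter-unique (keep _ f) (keep _ g)  = cong (_ ∷_) (Filter-unique f g)
  Filter-unique (keep p _) (drop ¬p _) = ⊥-elim (¬p p)
  Filter-unique (drop ¬p _) (keep p _) = ⊥-elim (¬p p)
  Filter-unique (drop _ f) (drop _ g)  = Filter-unique f g

  Filter-++ : ∀ {xs ys xs′ ys′} → Filter P xs ys → Filter P xs′ ys′ →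
              Filter P (xs ++ xs′) (ys ++ ys′)
  Filter-++ []          g = g
  Filter-++ (keep p f)  g = keep p (Filter-++ f g)
  Filter-++ (drop ¬p f) g = drop ¬p (Filter-++ f g)

  Filter-∈ : ∀ {xs ys y} → Filter P xs ys → y ∈ ys → y ∈ xs × P y
  Filter-∈ (keep p _) (here refl) = here refl , p
  Filter-∈ (keep _ f) (there y∈)  = let y∈xs , py = Filter-∈ f y∈ in there y∈xs , py
  Filter-∈ (drop _ f) y∈          = let y∈xs , py = Filter-∈ f y∈ in there y∈xs , py

  iters-Filter-[] : ∀ (f : X → X) k x → (∀ l → 1 ≤ l → l ≤ k → ¬ P (iterate f l x)) →
                    Filter P (iters f k x) []
  iters-Filter-[] f zero    x none = []
  iters-Filter-[] f (suc k) x none =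
    drop (none 1 (s≤s z≤n) (s≤s z≤n))
         (iters-Filter-[] f k (f x) (λ l _ l≤k → none (suc l) (s≤s z≤n) (s≤s l≤k)))

  iters-Filter-last : ∀ (f : X → X) k x → 1 ≤ k → (∀ l → 1 ≤ l → l < k → ¬ P (iterate f l x)) →
                      P (iterate f k x) → Filter P (iters f k x) [ iterate f k x ]
  iters-Filter-last f (suc zero)    x _ _    p = keep p []
  iters-Filter-last f (suc (suc k)) x _ none p =
    drop (none 1 (s≤s z≤n) (s≤s (s≤s z≤n)))
         (iters-Filter-last f (suc k) (f x) (s≤s z≤n)
                            (λ l _ l<k → none (suc l) (s≤s z≤n) (s≤s l<k)) p)

module _ (Acc : HA) where
  open HA Acc

  FinalFreeBelow : State Acc → ℕ → Set
  FinalFreeBelow s m = ∀ l → 1 ≤ l → l < m → ¬ IsFinal Acc (iterate T l s)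

  FinalFreeBelow-suc : ∀ {s m} → FinalFreeBelow s m → ¬ IsFinal Acc (iterate T m s) →
                       FinalFreeBelow s (suc m)
  FinalFreeBelow-suc free nonfinal l 1≤l l<1+m with m<1+n⇒m<n∨m≡n l<1+m
  ... | inj₁ l<m  = free l 1≤l l<m
  ... | inj₂ refl = nonfinal

  init⇒¬final : ∀ {s} → IsInit Acc s → ¬ IsFinal Acc s
  init⇒¬final {s} s-init s-final with halts s s-init
  ... | k , 1≤k , k-final , no-init = no-init k 1≤k ≤-refl (trans k-final (trans (sym s-final) s-init))

  ¬init-before-final : ∀ {s m} → IsInit Acc s → FinalFreeBelow s m → 1 ≤ m →
                       ¬ IsInit Acc (iterate T m s)
  ¬init-before-final {s} {m} s-init free 1≤m with halts s s-init
  ... | k , 1≤k , k-final , no-init = no-init m 1≤m (≮⇒≥ λ k<m → free k 1≤k k<m k-final)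

  run-initials : ∀ {s ss sf} → IsInit Acc s → Run Acc s ss sf → Filter (IsInit Acc) ss []
  run-initials {s} s-init (k , _ , refl , _ , _ , minimal) =
    iters-Filter-[] T k s λ l 1≤l l≤k →
      ¬init-before-final s-init (λ l′ 1≤l′ l′<l → minimal l′ 1≤l′ (<-≤-trans l′<l l≤k)) 1≤l

  run-finals : ∀ {s ss sf} → Run Acc s ss sf → Filter (IsFinal Acc) ss [ sf ]
  run-finals {s} (k , 1≤k , refl , refl , k-final , minimal) = iters-Filter-last T k s 1≤k minimal k-final

  lastInitial : ∀ {ins s₀ ss} → StateSeq Acc ins s₀ ss → State Acc
  lastInitial (one {i = i} {s₀ = s₀} _) = load Acc i s₀
  lastInitial (more _ p)                = lastInitial p

  lastFinal : ∀ {ins s₀ ss} → StateSeq Acc ins s₀ ss → State Acc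
  lastFinal (one {sf = sf} _) = sf
  lastFinal (more _ p)        = lastFinal p

  initials : ∀ {ins s₀ ss} → StateSeq Acc ins s₀ ss → List (State Acc)
  initials (one {i = i} {s₀ = s₀} _)    = [ load Acc i s₀ ]
  initials (more {i = i} {s₀ = s₀} _ p) = load Acc i s₀ ∷ initials p

  finals : ∀ {ins s₀ ss} → StateSeq Acc ins s₀ ss → List (State Acc)
  finals (one {sf = sf} _)    = [ sf ]
  finals (more {sf = sf} _ p) = sf ∷ finals p

  initials-Filter : ∀ {ins s₀ ss} → IsInit Acc s₀ → (p : StateSeq Acc ins s₀ ss) →
                    Filter (IsInit Acc) ss (initials p)
  initials-Filter s₀-init (one r) = keep s₀-init (run-initials s₀-init r)
  initials-Filter s₀-init (more r p) =
    keep s₀-init (Filter-++ (run-initials s₀-init r) (initials-Filter refl p))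

  finals-Filter : ∀ {ins s₀ ss} → IsInit Acc s₀ → (p : StateSeq Acc ins s₀ ss) →
                  Filter (IsFinal Acc) ss (finals p)
  finals-Filter {s₀ = s₀} s₀-init (one r) = drop (init⇒¬final {s₀} s₀-init) (run-finals r)
  finals-Filter {s₀ = s₀} s₀-init (more r p) =
    drop (init⇒¬final {s₀} s₀-init) (Filter-++ (run-finals r) (finals-Filter refl p))

  length-initials : ∀ {ins s₀ ss} → (p : StateSeq Acc ins s₀ ss) → length (initials p) ≡ length ins
  length-initials (one _)    = refl
  length-initials (more _ p) = cong suc (length-initials p)

  length-finals : ∀ {ins s₀ ss} → (p : StateSeq Acc ins s₀ ss) → length (finals p) ≡ length ins
  length-finals (one _)    = refl
  length-finals (more _ p) = cong suc (length-finals p)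

  inputs-∷ʳ : ∀ {ins s₀ ss} (p : StateSeq Acc ins s₀ ss) →
              ∃ λ ins′ → ins ≡ ins′ ∷ʳ inp Acc (lastInitial p)
  inputs-∷ʳ (one _) = [] , refl
  inputs-∷ʳ (more {i = i} _ p) = let ins′ , eq = inputs-∷ʳ p in i ∷ ins′ , cong (i ∷_) eq

  initials-∷ʳ : ∀ {ins s₀ ss} (p : StateSeq Acc ins s₀ ss) →
                ∃ λ is′ → initials p ≡ is′ ∷ʳ lastInitial p
  initials-∷ʳ (one _) = [] , refl
  initials-∷ʳ (more _ p) = let is′ , eq = initials-∷ʳ p in _ ∷ is′ , cong (_ ∷_) eq

  finals-∷ʳ : ∀ {ins s₀ ss} (p : StateSeq Acc ins s₀ ss) →
              ∃ λ fs′ → finals p ≡ fs′ ∷ʳ lastFinal p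
  finals-∷ʳ (one _) = [] , refl
  finals-∷ʳ (more _ p) = let fs′ , eq = finals-∷ʳ p in _ ∷ fs′ , cong (_ ∷_) eq

  length-Filter-initials : ∀ {ins s₀ ss is} → IsInit Acc s₀ → (p : StateSeq Acc ins s₀ ss) →
                           Filter (IsInit Acc) ss is → length is ≡ length ins
  length-Filter-initials s₀-init p f =
    trans (cong length (Filter-unique f (initials-Filter s₀-init p))) (length-initials p)

  length-Filter-finals : ∀ {ins s₀ ss fs} → IsInit Acc s₀ → (p : StateSeq Acc ins s₀ ss) →
                         Filter (IsFinal Acc) ss fs → length fs ≡ length ins
  length-Filter-finals s₀-init p f =
    trans (cong length (Filter-unique f (finals-Filter s₀-init p))) (length-finals p)

  lastFinal-unique : ∀ {ins s₀ ss fs fs′ sF} → IsInit Acc s₀ → (p : StateSeq Acc ins s₀ ss) →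
                     Filter (IsFinal Acc) ss fs → fs ≡ fs′ ∷ʳ sF → sF ≡ lastFinal p
  lastFinal-unique {fs′ = fs′} s₀-init p f refl =
    let gs , eq = finals-∷ʳ p
    in proj₂ (∷ʳ-injective fs′ gs (trans (Filter-unique f (finals-Filter s₀-init p)) eq))

  append : ∀ {ins s₀ ss ins₂ ss₂} (p : StateSeq Acc ins s₀ ss) →
           StateSeq Acc ins₂ (reset Acc (lastFinal p)) ss₂ →
           StateSeq Acc (ins ++ ins₂) s₀ (ss ++ ss₂)
  append (one r) q@(one _)    = more r q
  append (one r) q@(more _ _) = more r q
  append {s₀ = s₀} {ss₂ = ss₂} (more {i = i} {ss = ss} {rest = rest} r p) q =
    subst (λ xs → StateSeq Acc _ s₀ (load Acc i s₀ ∷ xs)) (sym (++-assoc ss rest ss₂))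
          (more r (append p q))

  record SeqEndingIn (s₀ y sf : State Acc) : Set where
    constructor seqEndingIn
    field
      {input}  : Batch Acc
      {inputs} : List (Batch Acc)
      {states} : List (State Acc)
      seq           : StateSeq Acc (input ∷ inputs) s₀ states
      lastInitial≡y : lastInitial seq ≡ y
      lastFinal≡sf  : lastFinal seq ≡ sf

  -- z is the m-th state of the run loaded from s₀ with batch i; since only the first state of a
  -- run is initial, the path can stop at y only right after a reload.
  path-within-run : ∀ {s₀ i m z y ss sf} → IsInit Acc s₀ → FinalFreeBelow (load Acc i s₀) m →
                    z ≡ iterate T m (load Acc i s₀) → Star (Step Acc) z y →
                    IsInit Acc y → Run Acc y ss sf → SeqEndingIn s₀ y sf
  path-within-run {m = zero} _ _ refl ε _ y-run = seqEndingIn (one y-run) refl refl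
  path-within-run {m = suc m} s₀-init free refl ε y-init _ =
    ⊥-elim (¬init-before-final s₀-init free (s≤s z≤n) y-init)
  path-within-run {s₀} {i} {m} s₀-init free refl (tstep nonfinal ◅ path) =
    path-within-run s₀-init (FinalFreeBelow-suc free nonfinal)
                    (sym (iterate-suc T m (load Acc i s₀))) path
  path-within-run {s₀} {m = zero} s₀-init _ refl (reload _ final ◅ _) _ _ =
    ⊥-elim (init⇒¬final {s₀} s₀-init final)
  path-within-run {s₀} {i} {suc m} s₀-init free refl (reload i′ final ◅ path) y-init y-run
    with path-within-run {m = 0} refl (λ _ _ ()) refl path y-init y-run
  ... | seqEndingIn q q-initial q-final =
    seqEndingIn (more (suc m , s≤s z≤n , refl , refl , final , free) q) q-initial q-final

  path-from-final : ∀ {f y ss sf} → IsFinal Acc f → Star (Step Acc) f y →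
                    IsInit Acc y → Run Acc y ss sf → SeqEndingIn (reset Acc f) y sf
  path-from-final {f} f-final ε y-init _ = ⊥-elim (init⇒¬final {f} y-init f-final)
  path-from-final f-final (tstep nonfinal ◅ _) _ _ = ⊥-elim (nonfinal f-final)
  path-from-final _ (reload _ _ ◅ path) = path-within-run {m = 0} refl (λ _ _ ()) refl path

  reachable-∈ : ∀ {s₀ ins ss s} → IsConcreteInit Acc s₀ → StateSeq Acc ins s₀ ss → s ∈ ss →
                Reachable Acc s
  reachable-∈ {s₀} {ins} {ss} s₀-init p s∈ss = inj₂ (s₀ , ins , ss , s₀-init , p , s∈ss)

  module _ (Spec : (A × D) × SR → O) where

    consistent-continuation :
      ∀ {s₀ ins ss is fs ins′ inₙ is′ sIₙ fs′ sFₙ ins₂ ss₂} →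
      FunctionallyConsistent Acc Spec → IsConcreteInit Acc s₀ → (p : StateSeq Acc ins s₀ ss) →
      Filter (IsInit Acc) ss is → Filter (IsFinal Acc) ss fs →
      ins ≡ ins′ ∷ʳ inₙ → is ≡ is′ ∷ʳ sIₙ → fs ≡ fs′ ∷ʳ sFₙ →
      (q : StateSeq Acc ins₂ (reset Acc sFₙ) ss₂) → ∀ j j′ →
      inₙ j ≡ inp Acc (lastInitial q) j′ → rel Acc sIₙ ≡ rel Acc (lastInitial q) →
      out Acc sFₙ j ≡ out Acc (lastFinal q) j′
    consistent-continuation {ins = ins} {is = is} {fs} {ins′}
                            cons s₀-cinit p f-init f-final eᵢₙ eᵢ e_f q
      with lastFinal-unique (proj₁ s₀-cinit) p f-final e_f
    ... | refl =
      cons _ s₀-cinit _ _ (append p q) _ _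
           (Filter-++ f-init (initials-Filter refl q)) (Filter-++ f-final (finals-Filter refl q))
           _ _ _ _ _ _
           (++-∷ʳ ins (proj₂ (inputs-∷ʳ q))) (++-∷ʳ is (proj₂ (initials-∷ʳ q)))
           (++-∷ʳ fs (proj₂ (finals-∷ʳ q)))
           (length ins′) _ _ _
           (At-∷ʳ-++ _ eᵢₙ eᵢₙ refl)
           (At-∷ʳ-++ _ eᵢ eᵢₙ (length-Filter-initials (proj₁ s₀-cinit) p f-init))
           (At-∷ʳ-++ _ e_f eᵢₙ (length-Filter-finals (proj₁ s₀-cinit) p f-final))

    consistent⇒correct : StronglyConnected Acc → SingleActionCorrect Acc Spec →
                         FunctionallyConsistent Acc Spec → FunctionallyCorrect Acc Spec
    consistent⇒correct connected single cons s₀ s₀-cinit ins ss p is fs f-init f-final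
                       ins′ inₙ is′ sIₙ fs′ sFₙ eᵢₙ eᵢ e_f j
      with Filter-∈ f-init (subst (sIₙ ∈_) (sym eᵢ) (∷ʳ-∈ is′ sIₙ))
         | Filter-∈ f-final (subst (sFₙ ∈_) (sym e_f) (∷ʳ-∈ fs′ sFₙ))
    ... | sIₙ∈ss , _ | sFₙ∈ss , sFₙ-final
      with single (inₙ j) (rel Acc sIₙ) (sIₙ , reachable-∈ s₀-cinit p sIₙ∈ss , refl)
    ... | y , y-reachable , y-init , j′ , y-input , y-rel , _ , _ , y-run , y-correct
      with path-from-final sFₙ-final (connected sFₙ y (reachable-∈ s₀-cinit p sFₙ∈ss) y-reachable)
                           y-init y-run
    ... | seqEndingIn q refl refl =
      trans (consistent-continuation cons s₀-cinit p f-init f-final eᵢₙ eᵢ e_f q j j′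
                                     (sym y-input) (sym y-rel))
            y-correct

lemma3 : (Acc : HA) (Spec : (HA.A Acc × HA.D Acc) × HA.SR Acc → HA.O Acc) →
    StronglyConnected Acc → SingleActionCorrect Acc Spec →
    ¬ FunctionallyCorrect Acc Spec → ¬ FunctionallyConsistent Acc Spec
lemma3 Acc Spec connected single incorrect consistent =
  incorrect (consistent⇒correct Acc Spec connected single consistent)
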